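{- Let $C$ be the chain of width $w$ and length $\ell$. Any minimal blocking set $B$ of $C$ that spreads over $d$ layers has $|B|\ge d+w-1$.
   Context: The chain of width $w$ and length $\ell$ has $\ell+1$ layers indexed $0,\dots,\ell$, each consisting of $w$ vertices indexed $0,\dots,w-1$; for each layer $i\ge1$, the $k$-th vertex of layer $i$ has exactly two incoming edges, from the $k$-th and the $((k+1)\bmod w)$-th vertices of layer $i-1$. Layer $0$ consists of the sources and layer $\ell$ of the sinks. A blocking set of a DAG is a set $B$ of vertices such that every directed path from a source to a sink contains a vertex of $B$; it is minimal if no proper subset of it is a blocking set. A blocking set spreads over $d$ layers if $a$ and $b$ are the lowest and highest layers containing a vertex of $B$ and $d=b-a+1$. -}

module Defs where

open import Data.Nat using (ℕ; zero; suc; _+_; _∸_; _≤_)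
open import Data.Fin using (Fin; toℕ; inject₁) renaming (suc to fsuc)
open import Data.Product using (_×_; _,_; Σ; ∃; proj₁)
open import Data.Sum using (_⊎_)
open import Data.List using (List; length)
open import Data.List.Membership.Propositional using (_∈_; _∉_)
open import Data.List.Relation.Unary.Unique.Propositional using (Unique)
open import Relation.Binary.PropositionalEquality using (_≡_)
open import Relation.Nullary using (¬_)

Vertex : ℕ → ℕ → Set
Vertex w ℓ = Fin (suc ℓ) × Fin w

layer : ∀ {w ℓ} → Vertex w ℓ → Fin (suc ℓ)
layer = proj₁

-- "m ≡ (k+1) mod w" for an index k < w
IsSuccMod : (w : ℕ) → ℕ → ℕ → Set
IsSuccMod w k m = (suc k ≡ m × ¬ (suc k ≡ w)) ⊎ (suc k ≡ w × m ≡ 0)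

Edge : ∀ {w ℓ} → Vertex w ℓ → Vertex w ℓ → Set
Edge {w} (i , j) (i' , k) =
  toℕ i' ≡ suc (toℕ i) × (toℕ j ≡ toℕ k ⊎ IsSuccMod w (toℕ k) (toℕ j))

-- Since every
-- edge goes from layer i-1 to layer i, such a path visits exactly one vertex
-- in each layer, so it is given by its index in each layer.
SourceSinkPath : ℕ → ℕ → Set
SourceSinkPath w ℓ =
  Σ (Fin (suc ℓ) → Fin w) λ p →
    (i : Fin ℓ) → Edge {w} {ℓ} (inject₁ i , p (inject₁ i)) (fsuc i , p (fsuc i))

OnPath : ∀ {w ℓ} → SourceSinkPath w ℓ → Vertex w ℓ → Set
OnPath (p , _) (i , k) = p i ≡ k

-- Finite vertex sets are represented as duplicate-free lists.
IsBlocking : ∀ w ℓ → List (Vertex w ℓ) → Set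
IsBlocking w ℓ B = (P : SourceSinkPath w ℓ) → ∃ λ v → v ∈ B × OnPath P v

_⊂_ : ∀ {A : Set} → List A → List A → Set
B' ⊂ B = (∀ {x} → x ∈ B' → x ∈ B) × ∃ λ x → x ∈ B × x ∉ B'

IsMinimalBlocking : ∀ w ℓ → List (Vertex w ℓ) → Set
IsMinimalBlocking w ℓ B =
  IsBlocking w ℓ B × (∀ B' → B' ⊂ B → ¬ IsBlocking w ℓ B')

SpreadsOver : ∀ {w ℓ} → List (Vertex w ℓ) → ℕ → Set
SpreadsOver {w} {ℓ} B d =
  Σ (Fin (suc ℓ)) λ a → Σ (Fin (suc ℓ)) λ b →
    (∃ λ v → v ∈ B × layer v ≡ a) ×
    (∀ v → v ∈ B → toℕ a ≤ toℕ (layer v)) ×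
    (∃ λ v → v ∈ B × layer v ≡ b) ×
    (∀ v → v ∈ B → toℕ (layer v) ≤ toℕ b) ×
    d ≡ suc (toℕ b ∸ toℕ a)

{-# OPTIONS --safe #-}
-- For a layer i let R_i be the set of its vertices that some source reaches along a path
-- avoiding B.  Up to the lowest layer a of B, R_i is the whole layer; from the highest layer b
-- on it is empty, since B blocks.  For a ≤ i < b minimality forces R_i to be neither empty (else
-- the vertices of B on layers ≤ i would already block) nor full (else those on layers > i would
-- block, as every path can be rerouted through layer i along an avoiding walk).  The vertices of
-- layer i + 1 with a predecessor in R_i form R_i ∪ (R_i − 1) on the cycle ℤ/w, which is strictly
-- larger than R_i when R_i is a nonempty proper subset, and R_{i+1} only loses the vertices of B
-- on layer i + 1.  Hence |B ∩ layer a| ≥ w − |R_a| and |B ∩ layer (i+1)| ≥ |R_i| + 1 − |R_{i+1}|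
-- for a ≤ i < b; summing gives |B| ≥ w + b − a.
module Submission where

open import Data.Nat using (ℕ; NonZero; zero; suc; _+_; _∸_; _≤_; _<_; z≤n; s≤s; _≟_; _≤?_; _<?_)
open import Data.Nat.Properties
open import Data.Nat.DivMod
  using (_%_; _mod_; m%n<n; m<n⇒m%n≡m; n%n≡0; m%n%n≡m%n; [m+n]%n≡m%n; %-distribˡ-+)
open import Data.Fin using (Fin; toℕ; inject₁; fromℕ<) renaming (suc to fsuc)
open import Data.Fin.Properties using (toℕ-injective; toℕ<n; toℕ-fromℕ<; toℕ-inject₁; ¬∀⟶∃¬)
open import Data.Fin.Subset
  using (Subset; inside; outside; _∈_; _∉_; _⊆_; _∪_; _─_; ∁; ⋃; ⁅_⁆; ⊤; ∣_∣; Nonempty)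
  renaming (⊥ to ∅)
open import Data.Fin.Subset.Properties
  using (_∈?_; nonempty?; ∈⊤; ∉⊥; ∣⊤∣≡n; ∣⊥∣≡0; ∣⁅x⁆∣≡1; ∣p∣≤∣x∷p∣; ∣p∣≤∣p∪q∣; x∈⁅x⁆; x∈⁅y⁆⇒x≡y;
         x∈p∪q⁺; x∈p∪q⁻; x∈p∧x∉q⇒x∈p─q; p─q⊆p; p⊆p∪q; p⊆q⇒∣p∣≤∣q∣; p⊂q⇒∣p∣<∣q∣; x∉p⇒x∈∁p; x∈∁p⇒x∉p)
open import Data.Vec using ([]; _∷_; tabulate; lookup; there)
open import Data.Vec.Properties using (lookup∘tabulate; []=⇒lookup; lookup⇒[]=)
open import Data.Product using (_×_; _,_; ∃; proj₁; proj₂; map₂)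
open import Data.Sum using (_⊎_; inj₁; inj₂)
open import Data.List using (List; []; _∷_; length; filter; map)
open import Data.List.Properties using (length-map; length-filter; filter-accept; filter-reject)
open import Data.List.Membership.Propositional using () renaming (_∈_ to _∈ˡ_)
open import Data.List.Membership.Propositional.Properties using (∈-filter⁺; ∈-filter⁻; ∈-map⁺; ∈-map⁻)
open import Data.List.Relation.Unary.Any using () renaming (here to hereˡ; there to thereˡ)
open import Data.List.Relation.Unary.Unique.Propositional using (Unique)
open import Relation.Binary.Definitions using (tri<; tri≈; tri>)
open import Relation.Binary.PropositionalEquality
open import Relation.Nullary using (¬_; yes; no; contradiction)
open import Relation.Unary using (Decidable)
open import Function using (_∘_; const)
open import Defs

toℕ-mod : ∀ m d .{{_ : NonZero d}} → toℕ (m mod d) ≡ m % d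
toℕ-mod m d = toℕ-fromℕ< (m%n<n m d)

mod-≡ : ∀ m {d} .{{_ : NonZero d}} {k : Fin d} → m % d ≡ toℕ k → m mod d ≡ k
mod-≡ m {d} m%d≡k = toℕ-injective (trans (toℕ-mod m d) m%d≡k)

crossing : ∀ {P : ℕ → Set} → Decidable P → ∀ m d → ¬ P m → P (m + d) → ∃ λ k → ¬ P k × P (suc k)
crossing {P} P? m zero ¬Pm Pm+0 = contradiction (subst P (+-identityʳ m) Pm+0) ¬Pm
crossing {P} P? m (suc d) ¬Pm Pm+d with P? (suc m)
... | yes Psm  = m , ¬Pm , Psm
... | no ¬Psm = crossing P? (suc m) d ¬Psm (subst P (+-suc m d) Pm+d)

module _ {A : Set} where

  splice : ℕ → (ℕ → A) → (ℕ → A) → ℕ → A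
  splice j f g t with t ≤? j
  ... | yes _ = f t
  ... | no  _ = g t

  splice-≤ : ∀ {j t} f g → t ≤ j → splice j f g t ≡ f t
  splice-≤ {j} {t} _ _ t≤j with t ≤? j
  ... | yes _   = refl
  ... | no  t≰j = contradiction t≤j t≰j

  splice-> : ∀ {j t} f g → j < t → splice j f g t ≡ g t
  splice-> {j} {t} _ _ j<t with t ≤? j
  ... | yes t≤j = contradiction t≤j (<⇒≱ j<t)
  ... | no  _   = refl

∣p∪q∣≤∣p∣+∣q∣ : ∀ {n} (p q : Subset n) → ∣ p ∪ q ∣ ≤ ∣ p ∣ + ∣ q ∣
∣p∪q∣≤∣p∣+∣q∣ []             []      = z≤n
∣p∪q∣≤∣p∣+∣q∣ (inside  ∷ p) (s ∷ q) = s≤s (≤-trans (∣p∪q∣≤∣p∣+∣q∣ p q) (+-monoʳ-≤ ∣ p ∣ (∣p∣≤∣x∷p∣ s q)))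
∣p∪q∣≤∣p∣+∣q∣ (outside ∷ p) (inside  ∷ q) =
  subst (suc ∣ p ∪ q ∣ ≤_) (sym (+-suc ∣ p ∣ ∣ q ∣)) (s≤s (∣p∪q∣≤∣p∣+∣q∣ p q))
∣p∪q∣≤∣p∣+∣q∣ (outside ∷ p) (outside ∷ q) = ∣p∪q∣≤∣p∣+∣q∣ p q

x∈p─q⇒x∉q : ∀ {n} {x : Fin n} (p q : Subset n) → x ∈ p ─ q → x ∉ q
x∈p─q⇒x∉q (_ ∷ p) (inside  ∷ q) (there x∈p─q) (there x∈q) = x∈p─q⇒x∉q p q x∈p─q x∈q
x∈p─q⇒x∉q (_ ∷ p) (outside ∷ q) (there x∈p─q) (there x∈q) = x∈p─q⇒x∉q p q x∈p─q x∈q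

∣p∣≤∣p─q∣+∣q∣ : ∀ {n} (p q : Subset n) → ∣ p ∣ ≤ ∣ p ─ q ∣ + ∣ q ∣
∣p∣≤∣p─q∣+∣q∣ p q = ≤-trans (p⊆q⇒∣p∣≤∣q∣ p⊆[p─q]∪q) (∣p∪q∣≤∣p∣+∣q∣ (p ─ q) q)
  where
  p⊆[p─q]∪q : p ⊆ (p ─ q) ∪ q
  p⊆[p─q]∪q {x} x∈p with x ∈? q
  ... | yes x∈q = x∈p∪q⁺ (inj₂ x∈q)
  ... | no  x∉q = x∈p∪q⁺ (inj₁ (x∈p∧x∉q⇒x∈p─q x∈p x∉q))

module _ {n : ℕ} where

  ∣⋃⁅⁆∣≤length : (xs : List (Fin n)) → ∣ ⋃ (map ⁅_⁆ xs) ∣ ≤ length xs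
  ∣⋃⁅⁆∣≤length []       = ≤-reflexive (∣⊥∣≡0 n)
  ∣⋃⁅⁆∣≤length (x ∷ xs) = ≤-trans (∣p∪q∣≤∣p∣+∣q∣ ⁅ x ⁆ (⋃ (map ⁅_⁆ xs)))
    (subst (λ c → c + _ ≤ suc (length xs)) (sym (∣⁅x⁆∣≡1 x)) (s≤s (∣⋃⁅⁆∣≤length xs)))

  ∈⋃⁅⁆⁺ : ∀ {x} {xs : List (Fin n)} → x ∈ˡ xs → x ∈ ⋃ (map ⁅_⁆ xs)
  ∈⋃⁅⁆⁺ (hereˡ refl) = x∈p∪q⁺ (inj₁ (x∈⁅x⁆ _))
  ∈⋃⁅⁆⁺ (thereˡ x∈xs) = x∈p∪q⁺ (inj₂ (∈⋃⁅⁆⁺ x∈xs))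

  ∈⋃⁅⁆⁻ : ∀ {x} (xs : List (Fin n)) → x ∈ ⋃ (map ⁅_⁆ xs) → x ∈ˡ xs
  ∈⋃⁅⁆⁻ []       x∈∅ = contradiction x∈∅ ∉⊥
  ∈⋃⁅⁆⁻ (y ∷ xs) x∈⋃ with x∈p∪q⁻ ⁅ y ⁆ _ x∈⋃
  ... | inj₁ x∈⁅y⁆ = hereˡ (x∈⁅y⁆⇒x≡y y x∈⁅y⁆)
  ... | inj₂ x∈xs  = thereˡ (∈⋃⁅⁆⁻ xs x∈xs)

module _ {A : Set} where

  filter-⊂ : ∀ {P : A → Set} (P? : Decidable P) {x xs} → x ∈ˡ xs → ¬ P x → filter P? xs ⊂ xs
  filter-⊂ P? {x} {xs} x∈xs ¬Px =
    proj₁ ∘ ∈-filter⁻ P? {xs = xs} , x , x∈xs , ¬Px ∘ proj₂ ∘ ∈-filter⁻ P? {xs = xs}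

  length-filter-<-suc : ∀ (f : A → ℕ) i xs →
    length (filter (λ y → f y <? suc i) xs) ≡
    length (filter (λ y → f y <? i) xs) + length (filter (λ y → f y ≟ i) xs)
  length-filter-<-suc f i [] = refl
  length-filter-<-suc f i (x ∷ xs) with <-cmp (f x) i
  ... | tri< fx<i fx≢i _ rewrite filter-accept (λ y → f y <? suc i) {x} {xs} (m<n⇒m<1+n fx<i)
                               | filter-accept (λ y → f y <? i) {x} {xs} fx<i
                               | filter-reject (λ y → f y ≟ i) {x} {xs} fx≢i =
    cong suc (length-filter-<-suc f i xs)
  ... | tri≈ fx≮i fx≡i _ rewrite filter-accept (λ y → f y <? suc i) {x} {xs} (s≤s (≤-reflexive fx≡i))
                               | filter-reject (λ y → f y <? i) {x} {xs} fx≮i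
                               | filter-accept (λ y → f y ≟ i) {x} {xs} fx≡i =
    trans (cong suc (length-filter-<-suc f i xs)) (sym (+-suc _ _))
  ... | tri> fx≮i fx≢i i<fx rewrite filter-reject (λ y → f y <? suc i) {x} {xs} (<⇒≱ i<fx ∘ ≤-pred)
                               | filter-reject (λ y → f y <? i) {x} {xs} fx≮i
                               | filter-reject (λ y → f y ≟ i) {x} {xs} fx≢i =
    length-filter-<-suc f i xs

module Cyclic (n : ℕ) where

  W : ℕ
  W = suc n

  toℕ-mod-toℕ : ∀ (k : Fin W) → toℕ k mod W ≡ k
  toℕ-mod-toℕ k = mod-≡ (toℕ k) (m<n⇒m%n≡m (toℕ<n k))

  sucMod : Fin W → Fin W
  sucMod k = suc (toℕ k) mod W

  toℕ-sucMod : ∀ k → toℕ (sucMod k) ≡ suc (toℕ k) % W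
  toℕ-sucMod k = toℕ-mod (suc (toℕ k)) W

  sucMod-mod : ∀ t → sucMod (t mod W) ≡ suc t mod W
  sucMod-mod t = toℕ-injective (begin
    toℕ (sucMod (t mod W))            ≡⟨ toℕ-sucMod (t mod W) ⟩
    suc (toℕ (t mod W)) % W           ≡⟨ cong (λ r → suc r % W) (toℕ-mod t W) ⟩
    (1 + t % W) % W                   ≡⟨ %-distribˡ-+ 1 (t % W) W ⟩
    (1 % W + t % W % W) % W           ≡⟨ cong (λ r → (1 % W + r) % W) (m%n%n≡m%n t W) ⟩
    (1 % W + t % W) % W               ≡⟨ %-distribˡ-+ 1 t W ⟨
    (1 + t) % W                       ≡⟨ toℕ-mod (suc t) W ⟨
    toℕ (suc t mod W)                 ∎)
    where open ≡-Reasoning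

  sucMod-IsSuccMod : ∀ k → IsSuccMod W (toℕ k) (toℕ (sucMod k))
  sucMod-IsSuccMod k with m≤n⇒m<n∨m≡n (toℕ<n k)
  ... | inj₁ 1+k<W = inj₁ (sym (trans (toℕ-sucMod k) (m<n⇒m%n≡m 1+k<W)) , <⇒≢ 1+k<W)
  ... | inj₂ 1+k≡W = inj₂ (1+k≡W , trans (toℕ-sucMod k) (trans (cong (_% W) 1+k≡W) (n%n≡0 W)))

  IsSuccMod⇒≡sucMod : ∀ {k j} → IsSuccMod W (toℕ k) (toℕ j) → j ≡ sucMod k
  IsSuccMod⇒≡sucMod {k} (inj₁ (1+k≡j , 1+k≢W)) =
    toℕ-injective (trans (sym 1+k≡j) (sym (trans (toℕ-sucMod k) (m<n⇒m%n≡m (≤∧≢⇒< (toℕ<n k) 1+k≢W)))))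
  IsSuccMod⇒≡sucMod {k} (inj₂ (1+k≡W , j≡0)) =
    toℕ-injective (trans j≡0 (sym (trans (toℕ-sucMod k) (trans (cong (_% W) 1+k≡W) (n%n≡0 W)))))

  rotate : Subset W → Subset W
  rotate S = tabulate (λ k → lookup S (sucMod k))

  ∈rotate⁺ : ∀ {S k} → sucMod k ∈ S → k ∈ rotate S
  ∈rotate⁺ {S} {k} σk∈S =
    lookup⇒[]= k (rotate S) (trans (lookup∘tabulate (lookup S ∘ sucMod) k) ([]=⇒lookup σk∈S))

  ∈rotate⁻ : ∀ {S k} → k ∈ rotate S → sucMod k ∈ S
  ∈rotate⁻ {S} {k} k∈rS =
    lookup⇒[]= (sucMod k) S (trans (sym (lookup∘tabulate (lookup S ∘ sucMod) k)) ([]=⇒lookup k∈rS))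

  -- Unfolding the cycle onto ℕ via t ↦ t mod W turns this into a crossing on a line.
  rotate-crossing : ∀ {S x y} → x ∈ S → y ∉ S → ∃ λ k → k ∉ S × sucMod k ∈ S
  rotate-crossing {S} {x} {y} x∈S y∉S
    with crossing (λ t → t mod W ∈? S) (toℕ y) (toℕ x + W ∸ toℕ y)
           (subst (_∉ S) (sym (toℕ-mod-toℕ y)) y∉S)
           (subst (λ t → t mod W ∈ S) (sym y+d≡x+W) x∈S′)
    where
    y+d≡x+W : toℕ y + (toℕ x + W ∸ toℕ y) ≡ toℕ x + W
    y+d≡x+W = m+[n∸m]≡n (≤-trans (<⇒≤ (toℕ<n y)) (m≤n+m W (toℕ x)))
    x+W≡x : (toℕ x + W) mod W ≡ x
    x+W≡x = mod-≡ (toℕ x + W) (trans ([m+n]%n≡m%n (toℕ x) W) (m<n⇒m%n≡m (toℕ<n x)))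
    x∈S′ : (toℕ x + W) mod W ∈ S
    x∈S′ = subst (_∈ S) (sym x+W≡x) x∈S
  ... | t , t∉S , t+1∈S = t mod W , t∉S , subst (_∈ S) (sym (sucMod-mod t)) t+1∈S

  ∣S∣<∣S∪rotateS∣ : ∀ S → Nonempty S → Nonempty (∁ S) → ∣ S ∣ < ∣ S ∪ rotate S ∣
  ∣S∣<∣S∪rotateS∣ S (x , x∈S) (y , y∈∁S) with rotate-crossing x∈S (x∈∁p⇒x∉p y∈∁S)
  ... | k , k∉S , σk∈S = p⊂q⇒∣p∣<∣q∣ (p⊆p∪q (rotate S) , k , x∈p∪q⁺ (inj₂ (∈rotate⁺ σk∈S)) , k∉S)

module Chain (n ℓ : ℕ) where
  open Cyclic n

  Step : Fin W → Fin W → Set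
  Step j k = j ≡ k ⊎ j ≡ sucMod k

  Walk : ℕ → (ℕ → Fin W) → Set
  Walk t g = ∀ s → s < t → Step (g s) (g (suc s))

  Walk-prefix : ∀ {t t′ g} → t ≤ t′ → Walk t′ g → Walk t g
  Walk-prefix t≤t′ walk s s<t = walk s (<-≤-trans s<t t≤t′)

  Walk-splice : ∀ {j t f g} → Walk j f → (∀ s → j < s → s < t → Step (g s) (g (suc s))) →
                (j < t → Step (f j) (g (suc j))) → Walk t (splice j f g)
  Walk-splice {j} {t} {f} {g} walkf walkg join s s<t with <-cmp s j
  ... | tri< s<j _ _ =
    subst₂ Step (sym (splice-≤ f g (<⇒≤ s<j))) (sym (splice-≤ f g s<j)) (walkf s s<j)
  ... | tri≈ _ refl _ =
    subst₂ Step (sym (splice-≤ f g (≤-refl {j}))) (sym (splice-> f g (n<1+n j))) (join s<t)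
  ... | tri> _ _ j<s =
    subst₂ Step (sym (splice-> f g j<s)) (sym (splice-> f g (m<n⇒m<1+n j<s))) (walkg s j<s s<t)

  Edge⇒Step : ∀ {i i′ j k} → Edge {W} {ℓ} (i , j) (i′ , k) → Step j k
  Edge⇒Step (_ , inj₁ j≡k)    = inj₁ (toℕ-injective j≡k)
  Edge⇒Step (_ , inj₂ j=k+1) = inj₂ (IsSuccMod⇒≡sucMod j=k+1)

  Step⇒Edge : ∀ {i j k} → Step j k → Edge {W} {ℓ} (inject₁ i , j) (fsuc i , k)
  Step⇒Edge {i} step = cong suc (sym (toℕ-inject₁ i)) , adjacent step
    where
    adjacent : ∀ {j k} → Step j k → toℕ j ≡ toℕ k ⊎ IsSuccMod W (toℕ k) (toℕ j)
    adjacent (inj₁ refl) = inj₁ refl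
    adjacent (inj₂ refl) = inj₂ (sucMod-IsSuccMod _)

  -- Layers beyond ℓ wrap around; only layers ≤ ℓ are ever looked at.
  toWalk : SourceSinkPath W ℓ → ℕ → Fin W
  toWalk (p , _) t = p (t mod suc ℓ)

  toWalk-at : ∀ P {t} (i : Fin (suc ℓ)) → toℕ i ≡ t → toWalk P t ≡ proj₁ P i
  toWalk-at (p , _) i refl = cong p (mod-≡ (toℕ i) (m<n⇒m%n≡m (toℕ<n i)))

  toWalk-Walk : ∀ P → Walk ℓ (toWalk P)
  toWalk-Walk P@(p , edge) s s<ℓ =
    subst₂ Step (sym (toWalk-at P (inject₁ i) (trans (toℕ-inject₁ i) i≡s)))
                (sym (toWalk-at P (fsuc i) (cong suc i≡s)))
                (Edge⇒Step (edge i))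
    where
    i : Fin ℓ
    i = fromℕ< s<ℓ
    i≡s : toℕ i ≡ s
    i≡s = toℕ-fromℕ< s<ℓ

  fromWalk : (g : ℕ → Fin W) → Walk ℓ g → SourceSinkPath W ℓ
  fromWalk g walk = g ∘ toℕ , λ i →
    subst (λ j → Edge (inject₁ i , j) (fsuc i , g (suc (toℕ i)))) (cong g (sym (toℕ-inject₁ i)))
          (Step⇒Edge (walk (toℕ i) (toℕ<n i)))

  blocking-meets-Walk : ∀ {B′} → IsBlocking W ℓ B′ → ∀ g → Walk ℓ g →
                        ∃ λ v → v ∈ˡ B′ × g (toℕ (layer v)) ≡ proj₂ v
  blocking-meets-Walk blocks g walk = blocks (fromWalk g walk)

  ∈∪rotate⁺ : ∀ {S j k} → Step j k → j ∈ S → k ∈ S ∪ rotate S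
  ∈∪rotate⁺ (inj₁ refl) j∈S = x∈p∪q⁺ (inj₁ j∈S)
  ∈∪rotate⁺ (inj₂ refl) j∈S = x∈p∪q⁺ (inj₂ (∈rotate⁺ j∈S))

  ∈∪rotate⁻ : ∀ {S k} → k ∈ S ∪ rotate S → ∃ λ j → Step j k × j ∈ S
  ∈∪rotate⁻ {S} {k} k∈ with x∈p∪q⁻ S (rotate S) k∈
  ... | inj₁ k∈S  = k , inj₁ refl , k∈S
  ... | inj₂ k∈rS = sucMod k , inj₂ refl , ∈rotate⁻ k∈rS

  module Avoiding (B : List (Vertex W ℓ)) where

    onLayer : ℕ → List (Vertex W ℓ)
    onLayer i = filter (λ v → toℕ (layer v) ≟ i) B

    B-layer : ℕ → Subset W
    B-layer i = ⋃ (map ⁅_⁆ (map proj₂ (onLayer i)))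

    ∈B-layer⁺ : ∀ {l k} → (l , k) ∈ˡ B → k ∈ B-layer (toℕ l)
    ∈B-layer⁺ {l} lk∈B = ∈⋃⁅⁆⁺ (∈-map⁺ proj₂ (∈-filter⁺ (λ v → toℕ (layer v) ≟ toℕ l) lk∈B refl))

    ∈B-layer⁻ : ∀ {i k} → k ∈ B-layer i → ∃ λ l → toℕ l ≡ i × (l , k) ∈ˡ B
    ∈B-layer⁻ {i} k∈ with ∈-map⁻ proj₂ (∈⋃⁅⁆⁻ (map proj₂ (onLayer i)) k∈)
    ... | (l , _) , lk∈ , refl with ∈-filter⁻ (λ v → toℕ (layer v) ≟ i) {xs = B} lk∈
    ... | lk∈B , l≡i = l , l≡i , lk∈B

    ∣B-layer∣≤∣onLayer∣ : ∀ i → ∣ B-layer i ∣ ≤ length (onLayer i)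
    ∣B-layer∣≤∣onLayer∣ i = ≤-trans (∣⋃⁅⁆∣≤length (map proj₂ (onLayer i)))
                                    (≤-reflexive (length-map proj₂ (onLayer i)))

    -- reach (suc i) is R_i; reach 0 = ⊤ acts as a virtual layer below the sources.
    reach : ℕ → Subset W
    reach zero    = ⊤
    reach (suc i) = (reach i ∪ rotate (reach i)) ─ B-layer i

    ∈reach-suc⁺ : ∀ {i j k} → Step j k → j ∈ reach i → k ∉ B-layer i → k ∈ reach (suc i)
    ∈reach-suc⁺ step j∈ k∉ = x∈p∧x∉q⇒x∈p─q (∈∪rotate⁺ step j∈) k∉

    Avoids : ℕ → (ℕ → Fin W) → Set
    Avoids i g = ∀ s → s ≤ i → g s ∉ B-layer s

    reach-sound : ∀ i {k} → k ∈ reach (suc i) → ∃ λ g → g i ≡ k × Walk i g × Avoids i g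
    reach-sound zero {k} k∈ = (λ _ → k) , refl , (λ _ ()) , λ { .0 z≤n → x∈p─q⇒x∉q _ _ k∈ }
    reach-sound (suc i) {k} k∈ with ∈∪rotate⁻ (p─q⊆p _ _ k∈)
    ... | j , step , j∈ with reach-sound i j∈
    ... | g , g[i]≡j , walk , avoids = h , splice-> g (const k) (n<1+n i) , walkh , avoidsh
      where
      h : ℕ → Fin W
      h = splice i g (const k)
      walkh : Walk (suc i) h
      walkh = Walk-splice walk (λ s i<s s<1+i → contradiction (≤-pred s<1+i) (<⇒≱ i<s))
                              (λ _ → subst (λ j′ → Step j′ k) (sym g[i]≡j) step)
      avoidsh : Avoids (suc i) h
      avoidsh s s≤1+i with m≤n⇒m<n∨m≡n s≤1+i
      ... | inj₁ s<1+i =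
        subst (_∉ B-layer s) (sym (splice-≤ g (const k) (≤-pred s<1+i))) (avoids s (≤-pred s<1+i))
      ... | inj₂ refl  =
        subst (_∉ B-layer (suc i)) (sym (splice-> g (const k) (n<1+n i))) (x∈p─q⇒x∉q _ _ k∈)

    walk-reaches-or-meets : ∀ t {g} → Walk t g → g t ∈ reach (suc t) ⊎ ∃ λ s → s ≤ t × g s ∈ B-layer s
    walk-reaches-or-meets zero {g} _ with g 0 ∈? B-layer 0
    ... | yes g0∈ = inj₂ (0 , z≤n , g0∈)
    ... | no  g0∉ = inj₁ (∈reach-suc⁺ (inj₁ refl) ∈⊤ g0∉)
    walk-reaches-or-meets (suc t) {g} walk
      with walk-reaches-or-meets t (Walk-prefix (n≤1+n t) walk) | g (suc t) ∈? B-layer (suc t)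
    ... | inj₂ (s , s≤t , meets) | _ = inj₂ (s , m≤n⇒m≤1+n s≤t , meets)
    ... | inj₁ _  | yes meets = inj₂ (suc t , ≤-refl , meets)
    ... | inj₁ gt∈ | no  g∉   = inj₁ (∈reach-suc⁺ (walk t ≤-refl) gt∈ g∉)

    below : ℕ → List (Vertex W ℓ)
    below i = filter (λ v → toℕ (layer v) <? i) B

    upTo : ℕ → List (Vertex W ℓ)
    upTo j = filter (λ v → toℕ (layer v) ≤? j) B

    above : ℕ → List (Vertex W ℓ)
    above j = filter (λ v → j <? toℕ (layer v)) B

    layer-growth : ∀ i → ∣ reach i ∪ rotate (reach i) ∣ + length (below i) ≤
                         ∣ reach (suc i) ∣ + length (below (suc i))
    layer-growth i = begin
      ∣ R ∪ rotate R ∣ + b   ≤⟨ +-monoˡ-≤ b (∣p∣≤∣p─q∣+∣q∣ (R ∪ rotate R) (B-layer i)) ⟩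
      (c + ∣ B-layer i ∣) + b ≤⟨ +-monoˡ-≤ b (+-monoʳ-≤ c (∣B-layer∣≤∣onLayer∣ i)) ⟩
      (c + o) + b            ≡⟨ +-assoc c o b ⟩
      c + (o + b)            ≡⟨ cong (c +_) (+-comm o b) ⟩
      c + (b + o)            ≡⟨ cong (c +_) (length-filter-<-suc (toℕ ∘ layer) i B) ⟨
      c + length (below (suc i)) ∎
      where
      open ≤-Reasoning
      R : Subset W
      R = reach i
      c b o : ℕ
      c = ∣ reach (suc i) ∣
      b = length (below i)
      o = length (onLayer i)

    blocking⇒reach-top-empty : IsBlocking W ℓ B → ∀ k → k ∉ reach (suc ℓ)
    blocking⇒reach-top-empty blocks k k∈ with reach-sound ℓ k∈
    ... | g , _ , walk , avoids with blocking-meets-Walk blocks g walk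
    ... | (l , m) , lm∈B , g[l]≡m =
      avoids (toℕ l) (≤-pred (toℕ<n l)) (subst (_∈ B-layer (toℕ l)) (sym g[l]≡m) (∈B-layer⁺ lm∈B))

    -- A walk avoiding B up to layer j can be continued along any source-sink path through its endpoint.
    reach-full⇒above-blocks : IsBlocking W ℓ B → ∀ j → (∀ k → k ∈ reach (suc j)) →
                              IsBlocking W ℓ (above j)
    reach-full⇒above-blocks blocks j full P with reach-sound j (full (toWalk P j))
    ... | g , g[j]≡p[j] , walkg , avoids with blocking-meets-Walk blocks (splice j g p) walkh
      where
      p : ℕ → Fin W
      p = toWalk P
      walkh : Walk ℓ (splice j g p)
      walkh = Walk-splice walkg (λ s _ s<ℓ → toWalk-Walk P s s<ℓ)
                (λ j<ℓ → subst (λ x → Step x (p (suc j))) (sym g[j]≡p[j]) (toWalk-Walk P j j<ℓ))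
    ... | (l , m) , lm∈B , h[l]≡m with j <? toℕ l
    ... | yes j<l = (l , m) , ∈-filter⁺ (λ v → j <? toℕ (layer v)) lm∈B j<l ,
                    trans (sym (toWalk-at P l refl)) (trans (sym (splice-> g (toWalk P) j<l)) h[l]≡m)
    ... | no  j≮l =
      contradiction (subst (_∈ B-layer (toℕ l)) (sym g[l]≡m) (∈B-layer⁺ lm∈B)) (avoids (toℕ l) l≤j)
      where
      l≤j : toℕ l ≤ j
      l≤j = ≮⇒≥ j≮l
      g[l]≡m : g (toℕ l) ≡ m
      g[l]≡m = trans (sym (splice-≤ g (toWalk P) l≤j)) h[l]≡m

    reach-empty⇒upTo-blocks : ∀ j → j ≤ ℓ → (∀ k → k ∉ reach (suc j)) → IsBlocking W ℓ (upTo j)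
    reach-empty⇒upTo-blocks j j≤ℓ empty P with walk-reaches-or-meets j (Walk-prefix j≤ℓ (toWalk-Walk P))
    ... | inj₁ p[j]∈ = contradiction p[j]∈ (empty _)
    ... | inj₂ (s , s≤j , p[s]∈) with ∈B-layer⁻ p[s]∈
    ... | l , l≡s , lp∈B = (l , toWalk P s) ,
                           ∈-filter⁺ (λ v → toℕ (layer v) ≤? j) lp∈B (subst (_≤ j) (sym l≡s) s≤j) ,
                           sym (toWalk-at P l l≡s)

    module Spread (blocks : IsBlocking W ℓ B) (minimal : ∀ B′ → B′ ⊂ B → ¬ IsBlocking W ℓ B′)
                  {a b : Fin (suc ℓ)} {va vb : Vertex W ℓ}
                  (va∈B : va ∈ˡ B) (layer[va]≡a : layer va ≡ a)
                  (a≤ : ∀ v → v ∈ˡ B → toℕ a ≤ toℕ (layer v))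
                  (vb∈B : vb ∈ˡ B) (layer[vb]≡b : layer vb ≡ b)
                  (≤b : ∀ v → v ∈ˡ B → toℕ (layer v) ≤ toℕ b)
                  where

      lo hi : ℕ
      lo = toℕ a
      hi = toℕ b

      B-layer-below-lo : ∀ {i k} → i < lo → k ∉ B-layer i
      B-layer-below-lo i<lo k∈ with ∈B-layer⁻ k∈
      ... | l , refl , lk∈B = <⇒≱ i<lo (a≤ _ lk∈B)

      B-layer-above-hi : ∀ {i k} → hi < i → k ∉ B-layer i
      B-layer-above-hi hi<i k∈ with ∈B-layer⁻ k∈
      ... | l , refl , lk∈B = <⇒≱ hi<i (≤b _ lk∈B)

      reach-full-upTo-lo : ∀ i → i ≤ lo → ∀ k → k ∈ reach i
      reach-full-upTo-lo zero    _     k = ∈⊤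
      reach-full-upTo-lo (suc i) 1+i≤lo k =
        ∈reach-suc⁺ (inj₁ refl) (reach-full-upTo-lo i (<⇒≤ 1+i≤lo) k) (B-layer-below-lo 1+i≤lo)

      reach-persists-above-hi : ∀ m {k} → k ∈ reach (suc hi) → k ∈ reach (suc (hi + m))
      reach-persists-above-hi zero {k} k∈ = subst (λ i → k ∈ reach (suc i)) (sym (+-identityʳ hi)) k∈
      reach-persists-above-hi (suc m) {k} k∈ = subst (λ i → k ∈ reach (suc i)) (sym (+-suc hi m))
        (∈reach-suc⁺ (inj₁ refl) (reach-persists-above-hi m k∈) (B-layer-above-hi (s≤s (m≤m+n hi m))))

      reach-empty-at-hi : ∀ k → k ∉ reach (suc hi)
      reach-empty-at-hi k k∈ = blocking⇒reach-top-empty blocks k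
        (subst (λ i → k ∈ reach (suc i)) (m+[n∸m]≡n (≤-pred (toℕ<n b)))
               (reach-persists-above-hi (ℓ ∸ hi) k∈))

      reach-nonempty : ∀ j → j < hi → Nonempty (reach (suc j))
      reach-nonempty j j<hi with nonempty? (reach (suc j))
      ... | yes nonempty = nonempty
      ... | no  empty    = contradiction
        (reach-empty⇒upTo-blocks j (<⇒≤ (<-≤-trans j<hi (≤-pred (toℕ<n b)))) λ k k∈ → empty (k , k∈))
        (minimal (upTo j) (filter-⊂ (λ v → toℕ (layer v) ≤? j) vb∈B
                                    (<⇒≱ (subst (j <_) (sym (cong toℕ layer[vb]≡b)) j<hi))))

      reach-not-full : ∀ j → lo ≤ j → Nonempty (∁ (reach (suc j)))
      reach-not-full j lo≤j = map₂ x∉p⇒x∈∁p (¬∀⟶∃¬ W (_∈ reach (suc j)) (_∈? reach (suc j)) not-full)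
        where
        not-full : ¬ (∀ k → k ∈ reach (suc j))
        not-full full = minimal (above j)
          (filter-⊂ (λ v → j <? toℕ (layer v)) va∈B
                    (≤⇒≯ (subst (_≤ j) (sym (cong toℕ layer[va]≡a)) lo≤j)))
          (reach-full⇒above-blocks blocks j full)

      lo≤hi : lo ≤ hi
      lo≤hi = subst (λ l → lo ≤ toℕ l) layer[vb]≡b (a≤ vb vb∈B)

      layer-count : ∀ t → lo + t ≤ hi → W + t ≤ ∣ reach (suc (lo + t)) ∣ + length (below (suc (lo + t)))
      layer-count zero _ rewrite +-identityʳ lo = begin
        W + 0                                      ≡⟨ +-identityʳ W ⟩
        W                                          ≡⟨ ∣⊤∣≡n W ⟨
        ∣ ⊤ {W} ∣                                  ≤⟨ p⊆q⇒∣p∣≤∣q∣ {p = ⊤} {q = R} ⊤⊆R ⟩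
        ∣ R ∣                                      ≤⟨ ∣p∣≤∣p∪q∣ R (rotate R) ⟩
        ∣ R ∪ rotate R ∣                           ≤⟨ m≤m+n _ (length (below lo)) ⟩
        ∣ R ∪ rotate R ∣ + length (below lo)       ≤⟨ layer-growth lo ⟩
        ∣ reach (suc lo) ∣ + length (below (suc lo)) ∎
        where
        open ≤-Reasoning
        R : Subset W
        R = reach lo
        ⊤⊆R : ⊤ ⊆ R
        ⊤⊆R {k} _ = reach-full-upTo-lo lo ≤-refl k
      layer-count (suc t) j<hi rewrite +-suc lo t = begin
        W + suc t                                  ≡⟨ +-suc W t ⟩
        suc (W + t)                                ≤⟨ s≤s (layer-count t (<⇒≤ j<hi)) ⟩
        suc (∣ R ∣ + length (below (suc j)))       ≤⟨ +-monoˡ-≤ _ R-grows ⟩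
        ∣ R ∪ rotate R ∣ + length (below (suc j))  ≤⟨ layer-growth (suc j) ⟩
        ∣ reach (suc (suc j)) ∣ + length (below (suc (suc j))) ∎
        where
        open ≤-Reasoning
        j : ℕ
        j = lo + t
        R : Subset W
        R = reach (suc j)
        R-grows : ∣ R ∣ < ∣ R ∪ rotate R ∣
        R-grows = ∣S∣<∣S∪rotateS∣ R (reach-nonempty j j<hi) (reach-not-full j (m≤m+n lo t))

      bound : hi ∸ lo + W ≤ length B
      bound = begin
        hi ∸ lo + W                                 ≡⟨ +-comm (hi ∸ lo) W ⟩
        W + (hi ∸ lo)                               ≤⟨ layer-count (hi ∸ lo) (≤-reflexive lo+t≡hi) ⟩
        ∣ reach (suc (lo + (hi ∸ lo))) ∣ + length (below (suc (lo + (hi ∸ lo))))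
          ≡⟨ cong (λ i → ∣ reach (suc i) ∣ + length (below (suc i))) lo+t≡hi ⟩
        ∣ reach (suc hi) ∣ + length (below (suc hi)) ≤⟨ +-monoˡ-≤ _ ∣reach∣≤0 ⟩
        length (below (suc hi))                     ≤⟨ length-filter (λ v → toℕ (layer v) <? suc hi) B ⟩
        length B                                    ∎
        where
        open ≤-Reasoning
        lo+t≡hi : lo + (hi ∸ lo) ≡ hi
        lo+t≡hi = m+[n∸m]≡n lo≤hi
        ∣reach∣≤0 : ∣ reach (suc hi) ∣ ≤ 0
        ∣reach∣≤0 = ≤-trans (p⊆q⇒∣p∣≤∣q∣ {q = ∅} (λ {k} k∈ → contradiction k∈ (reach-empty-at-hi k)))
                            (≤-reflexive (∣⊥∣≡0 W))

lemma4p3 : (w ℓ d : ℕ) (B : List (Vertex w ℓ)) →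
    Unique B → IsMinimalBlocking w ℓ B → SpreadsOver B d →
    d + w ∸ 1 ≤ length B
lemma4p3 zero    ℓ d B _ _ (_ , _ , ((_ , ()) , _) , _)
lemma4p3 (suc n) ℓ _ B _ (blocks , minimal)
         (a , b , (va , va∈B , layer[va]≡a) , a≤ , (vb , vb∈B , layer[vb]≡b) , ≤b , refl) =
  Chain.Avoiding.Spread.bound n ℓ B blocks minimal va∈B layer[va]≡a a≤ vb∈B layer[vb]≡b ≤b
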